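{- Let $S,T$ be numerical semigroups, $w\ge1$ an integer and $f\in\mathbb Z[x]$ such that $\mathrm H_S(x^w)f(x)=\mathrm H_T(x)$. Then (a) $f(0)=1$; (b) $f(1)=w$; (c) $f'(1)=w\bigl(\mathrm g(T)-w\,\mathrm g(S)+(w-1)/2\bigr)$; (d) $\mathrm F(T)=w\,\mathrm F(S)+\deg(f)$.
   Context: A numerical semigroup $S$ is a submonoid of $(\mathbb N,+)$ with finite complement; $\mathrm H_S(x)=\sum_{s\in S}x^s$ is its Hilbert series. $\mathrm g(S)=\#(\mathbb N\setminus S)$ is its genus, and $\mathrm F(S)$ is its Frobenius number, the largest integer not in $S$ ($-1$ if $S=\mathbb N$). -}

module Defs where

open import Data.Bool using (Bool; true; false; if_then_else_)
open import Data.Nat as ℕ using (ℕ; zero; suc; _≤_; NonZero)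
open import Data.Nat.DivMod using (_/_; _%_)
open import Data.Integer as ℤ using (ℤ; +_; -[1+_])
open import Data.List using (List; []; _∷_; upTo; map; foldr; length)
open import Relation.Binary.PropositionalEquality using (_≡_)

-- Membership is given by a Boolean characteristic function (such sets are
-- decidable); 'bound' is some N such that every n ≥ N lies in S (witnessing
-- that the complement is finite).
record NumericalSemigroup : Set where
  field
    mem     : ℕ → Bool
    zero∈   : mem 0 ≡ true
    closed  : ∀ m n → mem m ≡ true → mem n ≡ true → mem (m ℕ.+ n) ≡ true
    bound   : ℕ
    cofinite : ∀ n → bound ≤ n → mem n ≡ true
open NumericalSemigroup public

PowerSeries : Set
PowerSeries = ℕ → ℤ

hilbert : NumericalSemigroup → PowerSeries
hilbert S n = if mem S n then + 1 else + 0

-- Substitution x ↦ x^w in a power series (w ≥ 1).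
substPow : (w : ℕ) → .{{NonZero w}} → PowerSeries → PowerSeries
substPow w a n with n % w
... | zero  = a (n / w)
... | suc _ = + 0

-- Polynomials in ℤ[x] as coefficient lists (constant term first);
-- trailing zeros are allowed.
Poly : Set
Poly = List ℤ

coeff : Poly → ℕ → ℤ
coeff []       _       = + 0
coeff (a ∷ _)  zero    = a
coeff (_ ∷ as) (suc i) = coeff as i

sumℤ : List ℤ → ℤ
sumℤ = foldr ℤ._+_ (+ 0)

mulPolyPS : Poly → PowerSeries → PowerSeries
mulPolyPS f a n = sumℤ (map (λ i → coeff f i ℤ.* a (n ℕ.∸ i)) (upTo (suc n)))

evalAt0 : Poly → ℤ
evalAt0 f = coeff f 0

evalAt1 : Poly → ℤ
evalAt1 f = sumℤ f

derivAt1 : Poly → ℤ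
derivAt1 f = sumℤ (map (λ i → (+ i) ℤ.* coeff f i) (upTo (length f)))

-- Degree: index of the last nonzero coefficient (0 for the zero polynomial).
isZeroPoly : Poly → Bool
isZeroPoly []            = true
isZeroPoly ((+ zero) ∷ as) = isZeroPoly as
isZeroPoly ((+ suc _) ∷ _) = false
isZeroPoly (-[1+ _ ] ∷ _)  = false

deg : Poly → ℕ
deg []       = 0
deg (_ ∷ as) = if isZeroPoly as then 0 else suc (deg as)

-- Genus: number of gaps (all gaps lie below 'bound').
countGaps : (ℕ → Bool) → ℕ → ℕ
countGaps m zero    = 0
countGaps m (suc n) = if m n then countGaps m n else suc (countGaps m n)

genus : NumericalSemigroup → ℕ
genus S = countGaps (mem S) (bound S)

-- Frobenius number: largest gap, or -1 if S = ℕ.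
lastGap : (ℕ → Bool) → ℕ → ℤ
lastGap m zero    = -[1+ 0 ]
lastGap m (suc n) = if m n then lastGap m n else + n

frobenius : NumericalSemigroup → ℤ
frobenius S = lastGap (mem S) (bound S)

module Submission where

-- Multiplying the hypothesis H_S(xʷ)·f(x) = H_T(x) by 1 − xʷ gives the polynomial identity
--   f(x)·P_S(xʷ) = (1 + x + ⋯ + x^(w−1))·P_T(x),   where P_S(x) = (1 − x)·H_S(x).
-- P_S telescopes to P_S(1) = 1 and P_S'(1) = g(S), and has degree F(S) + 1 with leading
-- coefficient 1. Comparing values at 1, derivatives at 1 and degrees of the two sides gives
-- (b), (c) and (d); (a) is the constant term of the hypothesis.

open import Defs
open import Data.Nat using (ℕ; NonZero)
open import Data.Integer using (ℤ; +_; _+_; _-_; _*_)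
open import Data.Product using (_×_)
open import Relation.Binary.PropositionalEquality using (_≡_)

open import Data.Bool using (Bool; true; false; if_then_else_)
open import Data.Empty using (⊥-elim; ⊥-elim-irr)
open import Data.Integer using (-_; -1ℤ; -[1+_])
import Data.Integer.Properties as ℤₚ
open import Algebra.Properties.CommutativeSemigroup ℤₚ.+-commutativeSemigroup as +-CS using (interchange)
open import Algebra.Properties.CommutativeSemigroup ℤₚ.*-commutativeSemigroup as *-CS using ()
open import Data.Integer.Tactic.RingSolver using (solve-∀)
open import Data.List using ([]; _∷_; applyUpTo; map; length; replicate)
open import Data.Nat as ℕ using (zero; suc; _≤_; _<_; z≤n; s≤s)
import Data.Nat.Properties as ℕₚ
open import Data.Nat.DivMod using (_%_; _/_; m≡m%n+[m/n]*n; m<n⇒m%n≡m; [m+n]%n≡m%n; m/n≡1+[m∸n]/n)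
open import Data.Product using (_,_)
open import Function using (_∘_)
open import Relation.Binary.PropositionalEquality
  using (_≗_; _≢_; refl; sym; trans; cong; cong₂; subst; module ≡-Reasoning)
open import Relation.Nullary using (yes; no)

-- The value and the derivative at 1 of c truncated to degree < N.
total : ℕ → PowerSeries → ℤ
total N c = sumℤ (applyUpTo c N)

moment : ℕ → PowerSeries → ℤ
moment N c = total N (λ n → + n * c n)

VanishesFrom : ℕ → PowerSeries → Set
VanishesFrom K c = ∀ n → K ≤ n → c n ≡ + 0

nonzero⇒below-support : ∀ {K c p} → c p ≢ + 0 → VanishesFrom K c → p < K
nonzero⇒below-support {K} {p = p} cp≢0 c≡0 with p ℕ.<? K
... | yes p<K = p<K
... | no  p≮K = ⊥-elim (cp≢0 (c≡0 p (ℕₚ.≮⇒≥ p≮K)))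

scale-vanishes : ∀ x {K c} → VanishesFrom K c → VanishesFrom K (λ n → x * c n)
scale-vanishes x c≡0 n K≤n = trans (cong (_*_ x) (c≡0 n K≤n)) (ℤₚ.*-zeroʳ x)

total-cong : ∀ N {c d : PowerSeries} → c ≗ d → total N c ≡ total N d
total-cong zero    c≗d = refl
total-cong (suc N) c≗d = cong₂ _+_ (c≗d 0) (total-cong N (c≗d ∘ suc))

total-zero : ∀ N c → (∀ n → n < N → c n ≡ + 0) → total N c ≡ + 0
total-zero zero    c z = refl
total-zero (suc N) c z = cong₂ _+_ (z 0 (s≤s z≤n)) (total-zero N (c ∘ suc) (λ n n<N → z (suc n) (s≤s n<N)))

total-add : ∀ N c d → total N (λ n → c n + d n) ≡ total N c + total N d
total-add zero    c d = refl
total-add (suc N) c d =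
  trans (cong (_+_ (c 0 + d 0)) (total-add N (c ∘ suc) (d ∘ suc))) (interchange (c 0) (d 0) _ _)

total-scale : ∀ N k c → total N (λ n → k * c n) ≡ k * total N c
total-scale zero    k c = sym (ℤₚ.*-zeroʳ k)
total-scale (suc N) k c =
  trans (cong (_+_ (k * c 0)) (total-scale N k (c ∘ suc))) (sym (ℤₚ.*-distribˡ-+ k (c 0) _))

total-neg : ∀ N c → total N (λ n → - c n) ≡ - total N c
total-neg N c = trans (total-cong N (λ n → sym (ℤₚ.-1*i≡-i (c n)))) (trans (total-scale N -1ℤ c) (ℤₚ.-1*i≡-i _))

total-sub : ∀ N c d → total N (λ n → c n - d n) ≡ total N c - total N d
total-sub N c d = trans (total-add N c (-_ ∘ d)) (cong (_+_ (total N c)) (total-neg N d))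

total-snoc : ∀ N c → total (suc N) c ≡ total N c + c N
total-snoc zero    c = trans (ℤₚ.+-identityʳ (c 0)) (sym (ℤₚ.+-identityˡ (c 0)))
total-snoc (suc N) c = trans (cong (_+_ (c 0)) (total-snoc N (c ∘ suc))) (sym (ℤₚ.+-assoc (c 0) _ _))

total-split : ∀ K N c → total (K ℕ.+ N) c ≡ total K c + total N (λ n → c (K ℕ.+ n))
total-split zero    N c = sym (ℤₚ.+-identityˡ _)
total-split (suc K) N c = trans (cong (_+_ (c 0)) (total-split K N (c ∘ suc))) (sym (ℤₚ.+-assoc (c 0) _ _))

total-stable : ∀ {K N c} → VanishesFrom K c → K ≤ N → total N c ≡ total K c
total-stable {K} {N} {c} c≡0 K≤N = begin
  total N c                                         ≡⟨ cong (λ M → total M c) (sym (ℕₚ.m+[n∸m]≡n K≤N)) ⟩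
  total (K ℕ.+ (N ℕ.∸ K)) c                         ≡⟨ total-split K (N ℕ.∸ K) c ⟩
  total K c + total (N ℕ.∸ K) (λ n → c (K ℕ.+ n))   ≡⟨ cong (_+_ (total K c)) (total-zero (N ℕ.∸ K) _ (λ n _ → c≡0 _ (ℕₚ.m≤m+n K n))) ⟩
  total K c + + 0                                   ≡⟨ ℤₚ.+-identityʳ _ ⟩
  total K c                                         ∎
  where open ≡-Reasoning

moment-cong : ∀ N {c d : PowerSeries} → c ≗ d → moment N c ≡ moment N d
moment-cong N c≗d = total-cong N (λ n → cong (_*_ (+ n)) (c≗d n))

moment-suc : ∀ N c → moment (suc N) c ≡ moment N (c ∘ suc) + total N (c ∘ suc)
moment-suc N c = trans (ℤₚ.+-identityˡ _) (trans (total-cong N weight-suc) (total-add N _ (c ∘ suc)))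
  where
  weight-suc : ∀ n → + suc n * c (suc n) ≡ + n * c (suc n) + c (suc n)
  weight-suc n = trans (cong (_* c (suc n)) (ℤₚ.pos-+ 1 n)) (lemma (+ n) (c (suc n)))
    where
    lemma : ∀ m x → (+ 1 + m) * x ≡ m * x + x
    lemma = solve-∀

moment-snoc : ∀ N c → moment (suc N) c ≡ moment N c + + N * c N
moment-snoc N c = total-snoc N (λ n → + n * c n)

moment-add : ∀ N c d → moment N (λ n → c n + d n) ≡ moment N c + moment N d
moment-add N c d = trans (total-cong N (λ n → ℤₚ.*-distribˡ-+ (+ n) (c n) (d n))) (total-add N _ _)

moment-scale : ∀ N k c → moment N (λ n → k * c n) ≡ k * moment N c
moment-scale N k c = trans (total-cong N (λ n → *-CS.x∙yz≈y∙xz (+ n) k (c n))) (total-scale N k _)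

moment-sub : ∀ N c d → moment N (λ n → c n - d n) ≡ moment N c - moment N d
moment-sub N c d = trans (total-cong N (λ n → distrib (+ n) (c n) (d n))) (total-sub N _ _)
  where
  distrib : ∀ k x y → k * (x - y) ≡ k * x - k * y
  distrib = solve-∀

moment-split : ∀ K N c → moment (K ℕ.+ N) c ≡
               moment K c + (moment N (λ n → c (K ℕ.+ n)) + + K * total N (λ n → c (K ℕ.+ n)))
moment-split K N c = begin
  moment (K ℕ.+ N) c
    ≡⟨ total-split K N (λ n → + n * c n) ⟩
  moment K c + total N (λ n → + (K ℕ.+ n) * c′ n)
    ≡⟨ cong (_+_ (moment K c)) (total-cong N weight-split) ⟩
  moment K c + total N (λ n → + n * c′ n + + K * c′ n)
    ≡⟨ cong (_+_ (moment K c)) (trans (total-add N _ _) (cong (_+_ (moment N c′)) (total-scale N (+ K) c′))) ⟩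
  moment K c + (moment N c′ + + K * total N c′) ∎
  where
  open ≡-Reasoning
  c′ : PowerSeries
  c′ n = c (K ℕ.+ n)
  weight-split : ∀ n → + (K ℕ.+ n) * c′ n ≡ + n * c′ n + + K * c′ n
  weight-split n = trans (cong (_* c′ n) (trans (ℤₚ.pos-+ K n) (ℤₚ.+-comm (+ K) (+ n)))) (ℤₚ.*-distribʳ-+ (c′ n) (+ n) (+ K))

moment-stable : ∀ {K N c} → VanishesFrom K c → K ≤ N → moment N c ≡ moment K c
moment-stable c≡0 = total-stable (λ n K≤n → trans (cong (_*_ (+ n)) (c≡0 n K≤n)) (ℤₚ.*-zeroʳ (+ n)))

-- Polynomials

map-applyUpTo : ∀ (g : ℕ → ℤ) (h : ℕ → ℕ) n → map g (applyUpTo h n) ≡ applyUpTo (g ∘ h) n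
map-applyUpTo g h zero    = refl
map-applyUpTo g h (suc n) = cong (g (h 0) ∷_) (map-applyUpTo g (h ∘ suc) n)

total-coeff : ∀ f → total (length f) (coeff f) ≡ sumℤ f
total-coeff []      = refl
total-coeff (x ∷ f) = cong (_+_ x) (total-coeff f)

derivAt1≡moment : ∀ f → derivAt1 f ≡ moment (length f) (coeff f)
derivAt1≡moment f = cong sumℤ (map-applyUpTo (λ i → + i * coeff f i) (λ i → i) (length f))

derivAt1-∷ : ∀ x f → derivAt1 (x ∷ f) ≡ derivAt1 f + sumℤ f
derivAt1-∷ x f = begin
  derivAt1 (x ∷ f)                                         ≡⟨ derivAt1≡moment (x ∷ f) ⟩
  moment (suc (length f)) (coeff (x ∷ f))                  ≡⟨ moment-suc (length f) (coeff (x ∷ f)) ⟩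
  moment (length f) (coeff f) + total (length f) (coeff f) ≡⟨ cong₂ _+_ (sym (derivAt1≡moment f)) (total-coeff f) ⟩
  derivAt1 f + sumℤ f                                      ∎
  where open ≡-Reasoning

sumℤ-replicate-one : ∀ k → sumℤ (replicate k (+ 1)) ≡ + k
sumℤ-replicate-one zero    = refl
sumℤ-replicate-one (suc k) = trans (cong (_+_ (+ 1)) (sumℤ-replicate-one k)) (sym (ℤₚ.pos-+ 1 k))

derivAt1-replicate-one : ∀ k → + 2 * derivAt1 (replicate k (+ 1)) ≡ + k * (+ k - + 1)
derivAt1-replicate-one zero    = refl
derivAt1-replicate-one (suc k) = begin
  + 2 * derivAt1 (+ 1 ∷ ones)                   ≡⟨ cong (_*_ (+ 2)) (derivAt1-∷ (+ 1) ones) ⟩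
  + 2 * (derivAt1 ones + sumℤ ones)             ≡⟨ cong (λ s → + 2 * (derivAt1 ones + s)) (sumℤ-replicate-one k) ⟩
  + 2 * (derivAt1 ones + + k)                   ≡⟨ ℤₚ.*-distribˡ-+ (+ 2) (derivAt1 ones) (+ k) ⟩
  + 2 * derivAt1 ones + + 2 * + k               ≡⟨ cong (_+ + 2 * + k) (derivAt1-replicate-one k) ⟩
  + k * (+ k - + 1) + + 2 * + k                 ≡⟨ lemma (+ k) ⟩
  (+ 1 + + k) * ((+ 1 + + k) - + 1)             ≡⟨ cong (λ m → m * (m - + 1)) (sym (ℤₚ.pos-+ 1 k)) ⟩
  + suc k * (+ suc k - + 1)                     ∎
  where
  open ≡-Reasoning
  ones : Poly
  ones = replicate k (+ 1)
  lemma : ∀ m → m * (m - + 1) + + 2 * m ≡ (+ 1 + m) * ((+ 1 + m) - + 1)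
  lemma = solve-∀

coeff-replicate-< : ∀ {k i} (a : ℤ) → i < k → coeff (replicate k a) i ≡ a
coeff-replicate-< {suc k} {zero}  a _           = refl
coeff-replicate-< {suc k} {suc i} a (s≤s i<k) = coeff-replicate-< a i<k

coeff-replicate-vanishes : ∀ k (a : ℤ) → VanishesFrom k (coeff (replicate k a))
coeff-replicate-vanishes zero    a n       _         = refl
coeff-replicate-vanishes (suc k) a (suc n) (s≤s k≤n) = coeff-replicate-vanishes k a n k≤n

isZeroPoly-coeff : ∀ f → isZeroPoly f ≡ true → ∀ i → coeff f i ≡ + 0
isZeroPoly-coeff []                f≡0 i       = refl
isZeroPoly-coeff (+ zero ∷ f)      f≡0 zero    = refl
isZeroPoly-coeff (+ zero ∷ f)      f≡0 (suc i) = isZeroPoly-coeff f f≡0 i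

isZeroPoly≡false : ∀ f {i} → coeff f i ≢ + 0 → isZeroPoly f ≡ false
isZeroPoly≡false f {i} fᵢ≢0 with isZeroPoly f in f≡0
... | true  = ⊥-elim (fᵢ≢0 (isZeroPoly-coeff f f≡0 i))
... | false = refl

coeff-vanishes-above-deg : ∀ f → VanishesFrom (suc (deg f)) (coeff f)
coeff-vanishes-above-deg []      i       _ = refl
coeff-vanishes-above-deg (a ∷ f) (suc i) deg<i with isZeroPoly f in f≡0
... | true  = isZeroPoly-coeff f f≡0 i
... | false = coeff-vanishes-above-deg f i (ℕ.s≤s⁻¹ deg<i)

leadingCoeff≢0 : ∀ f → isZeroPoly f ≡ false → coeff f (deg f) ≢ + 0
leadingCoeff≢0 (a ∷ f) a∷f≢0 with isZeroPoly f in f≡0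
leadingCoeff≢0 (+ zero ∷ f)    a∷f≢0 | true  with () ← trans (sym f≡0) a∷f≢0
leadingCoeff≢0 (+ suc _ ∷ f)   _     | true  = λ ()
leadingCoeff≢0 (-[1+ _ ] ∷ f)  _     | true  = λ ()
leadingCoeff≢0 (a ∷ f)         _     | false = leadingCoeff≢0 f f≡0

-- Products of polynomials and power series

shift : PowerSeries → PowerSeries
shift c zero    = + 0
shift c (suc n) = c n

shiftBy : ℕ → PowerSeries → PowerSeries
shiftBy zero    c = c
shiftBy (suc k) c = shift (shiftBy k c)

infixl 6 _⊖_
_⊖_ : PowerSeries → PowerSeries → PowerSeries
(a ⊖ b) n = a n - b n

shift-cong : ∀ {a b} → a ≗ b → shift a ≗ shift b
shift-cong a≗b zero    = refl
shift-cong a≗b (suc n) = a≗b n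

shiftBy-cong : ∀ k {a b} → a ≗ b → shiftBy k a ≗ shiftBy k b
shiftBy-cong zero    a≗b = a≗b
shiftBy-cong (suc k) a≗b = shift-cong (shiftBy-cong k a≗b)

shift-⊖ : ∀ a b → shift (a ⊖ b) ≗ shift a ⊖ shift b
shift-⊖ a b zero    = refl
shift-⊖ a b (suc n) = refl

shift-vanishes : ∀ {K c} → VanishesFrom K c → VanishesFrom (suc K) (shift c)
shift-vanishes c≡0 (suc n) (s≤s K≤n) = c≡0 n K≤n

shiftBy-< : ∀ k c {n} → n < k → shiftBy k c n ≡ + 0
shiftBy-< (suc k) c {zero}  _         = refl
shiftBy-< (suc k) c {suc n} (s≤s n<k) = shiftBy-< k c n<k

shiftBy-+ : ∀ k c n → shiftBy k c (k ℕ.+ n) ≡ c n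
shiftBy-+ zero    c n = refl
shiftBy-+ (suc k) c n = shiftBy-+ k c n

total-⊖shift : ∀ M h → total (suc M) (h ⊖ shift h) ≡ h M
total-⊖shift M h = begin
  total (suc M) (h ⊖ shift h)               ≡⟨ total-sub (suc M) h (shift h) ⟩
  total (suc M) h - (+ 0 + total M h)       ≡⟨ cong₂ _-_ (total-snoc M h) (ℤₚ.+-identityˡ _) ⟩
  (total M h + h M) - total M h             ≡⟨ lemma (total M h) (h M) ⟩
  h M                                       ∎
  where
  open ≡-Reasoning
  lemma : ∀ t x → (t + x) - t ≡ x
  lemma = solve-∀

moment-⊖shift : ∀ M h → moment (suc M) (h ⊖ shift h) ≡ + M * h M - total M h
moment-⊖shift M h = begin
  moment (suc M) (h ⊖ shift h)                          ≡⟨ moment-sub (suc M) h (shift h) ⟩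
  moment (suc M) h - moment (suc M) (shift h)           ≡⟨ cong₂ _-_ (moment-snoc M h) (moment-suc M (shift h)) ⟩
  (moment M h + + M * h M) - (moment M h + total M h)   ≡⟨ lemma (moment M h) (+ M * h M) (total M h) ⟩
  + M * h M - total M h                                 ∎
  where
  open ≡-Reasoning
  lemma : ∀ m x t → (m + x) - (m + t) ≡ x - t
  lemma = solve-∀

-- f·a by Horner's rule: (x + t·f)·a = x·a + t·(f·a).
polyMul : Poly → PowerSeries → PowerSeries
polyMul []      a n = + 0
polyMul (x ∷ f) a n = x * a n + shift (polyMul f a) n

mulPolyPS≡total : ∀ f a n → mulPolyPS f a n ≡ total (suc n) (λ i → coeff f i * a (n ℕ.∸ i))
mulPolyPS≡total f a n = cong sumℤ (map-applyUpTo (λ i → coeff f i * a (n ℕ.∸ i)) (λ i → i) (suc n))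

mulPolyPS≗polyMul : ∀ f a → mulPolyPS f a ≗ polyMul f a
mulPolyPS≗polyMul []      a n       = trans (mulPolyPS≡total [] a n) (total-zero (suc n) _ (λ _ _ → refl))
mulPolyPS≗polyMul (x ∷ f) a zero    = refl
mulPolyPS≗polyMul (x ∷ f) a (suc n) = trans (mulPolyPS≡total (x ∷ f) a (suc n))
  (cong (_+_ (x * a (suc n))) (trans (sym (mulPolyPS≡total f a n)) (mulPolyPS≗polyMul f a n)))

polyMul-cong : ∀ f {a b} → a ≗ b → polyMul f a ≗ polyMul f b
polyMul-cong []      a≗b n = refl
polyMul-cong (x ∷ f) a≗b n = cong₂ _+_ (cong (_*_ x) (a≗b n)) (shift-cong (polyMul-cong f a≗b) n)

polyMul-shift : ∀ f a → polyMul f (shift a) ≗ shift (polyMul f a)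
polyMul-shift []      a zero    = refl
polyMul-shift []      a (suc n) = refl
polyMul-shift (x ∷ f) a zero    = trans (ℤₚ.+-identityʳ _) (ℤₚ.*-zeroʳ x)
polyMul-shift (x ∷ f) a (suc n) = cong (_+_ (x * a n)) (polyMul-shift f a n)

polyMul-shiftBy : ∀ f k a → polyMul f (shiftBy k a) ≗ shiftBy k (polyMul f a)
polyMul-shiftBy f zero    a n = refl
polyMul-shiftBy f (suc k) a n =
  trans (polyMul-shift f (shiftBy k a) n) (shift-cong (polyMul-shiftBy f k a) n)

polyMul-⊖ : ∀ f a b → polyMul f (a ⊖ b) ≗ polyMul f a ⊖ polyMul f b
polyMul-⊖ []      a b n = refl
polyMul-⊖ (x ∷ f) a b n = begin
  x * (a n - b n) + shift (polyMul f (a ⊖ b)) n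
    ≡⟨ cong (_+_ (x * (a n - b n))) (shift-cong (polyMul-⊖ f a b) n) ⟩
  x * (a n - b n) + shift (polyMul f a ⊖ polyMul f b) n
    ≡⟨ cong (_+_ (x * (a n - b n))) (shift-⊖ (polyMul f a) (polyMul f b) n) ⟩
  x * (a n - b n) + (shift (polyMul f a) n - shift (polyMul f b) n)
    ≡⟨ lemma x (a n) (b n) _ _ ⟩
  (x * a n + shift (polyMul f a) n) - (x * b n + shift (polyMul f b) n) ∎
  where
  open ≡-Reasoning
  lemma : ∀ x p q r s → x * (p - q) + (r - s) ≡ (x * p + r) - (x * q + s)
  lemma = solve-∀

polyMul-0 : ∀ f a → polyMul f a 0 ≡ coeff f 0 * a 0
polyMul-0 []      a = refl
polyMul-0 (x ∷ f) a = ℤₚ.+-identityʳ _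

polyMul-replicate-one : ∀ k h → polyMul (replicate k (+ 1)) (h ⊖ shift h) ≗ h ⊖ shiftBy k h
polyMul-replicate-one zero    h n       = sym (ℤₚ.+-inverseʳ (h n))
polyMul-replicate-one (suc k) h zero    = lemma (h 0)
  where
  lemma : ∀ a → + 1 * (a - + 0) + + 0 ≡ a - + 0
  lemma = solve-∀
polyMul-replicate-one (suc k) h (suc n) =
  trans (cong (_+_ (+ 1 * (h (suc n) - h n))) (polyMul-replicate-one k h n)) (lemma (h (suc n)) (h n) _)
  where
  lemma : ∀ a b c → + 1 * (a - b) + (b - c) ≡ a - c
  lemma = solve-∀

polyMul-zero : ∀ f a → (∀ i → coeff f i ≡ + 0) → ∀ n → polyMul f a n ≡ + 0
polyMul-zero []      a f≡0 n       = refl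
polyMul-zero (x ∷ f) a f≡0 zero    = trans (ℤₚ.+-identityʳ _) (cong (_* a 0) (f≡0 0))
polyMul-zero (x ∷ f) a f≡0 (suc n) =
  cong₂ _+_ (cong (_* a (suc n)) (f≡0 0)) (polyMul-zero f a (f≡0 ∘ suc) n)

polyMul-vanishes : ∀ f {b} D P → VanishesFrom (suc D) (coeff f) → VanishesFrom (suc P) b →
                   VanishesFrom (suc (D ℕ.+ P)) (polyMul f b)
polyMul-vanishes []      D P f≡0 b≡0 n _ = refl
polyMul-vanishes (x ∷ f) {b} zero P f≡0 b≡0 n P<n =
  cong₂ _+_ (scale-vanishes x b≡0 n P<n)
            (shift-vanishes (λ m _ → polyMul-zero f b (λ i → f≡0 (suc i) (s≤s z≤n)) m) n (ℕₚ.≤-trans (s≤s z≤n) P<n))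
polyMul-vanishes (x ∷ f) (suc D) P f≡0 b≡0 n D+P<n =
  cong₂ _+_ (scale-vanishes x b≡0 n (ℕₚ.≤-trans (s≤s (ℕₚ.m≤n+m P (suc D))) D+P<n))
            (shift-vanishes (polyMul-vanishes f D P (λ i D<i → f≡0 (suc i) (s≤s D<i)) b≡0) n D+P<n)

polyMul-leading : ∀ f {b} D P → VanishesFrom (suc D) (coeff f) → VanishesFrom (suc P) b →
                  polyMul f b (D ℕ.+ P) ≡ coeff f D * b P
polyMul-leading []      D P f≡0 b≡0 = refl
polyMul-leading (x ∷ f) {b} zero P f≡0 b≡0 =
  trans (cong (_+_ (x * b P)) (shift-zero P)) (ℤₚ.+-identityʳ _)
  where
  shift-zero : ∀ n → shift (polyMul f b) n ≡ + 0
  shift-zero zero    = refl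
  shift-zero (suc n) = polyMul-zero f b (λ i → f≡0 (suc i) (s≤s z≤n)) n
polyMul-leading (x ∷ f) (suc D) P f≡0 b≡0 =
  trans (cong₂ _+_ (scale-vanishes x b≡0 _ (s≤s (ℕₚ.m≤n+m P D))) (polyMul-leading f D P (λ i D<i → f≡0 (suc i) (s≤s D<i)) b≡0))
        (ℤₚ.+-identityˡ _)

total-polyMul : ∀ f {b K N} → VanishesFrom K b → length f ℕ.+ K ≤ N →
                total N (polyMul f b) ≡ sumℤ f * total K b
total-polyMul []      {N = N} _ _ = total-zero N _ (λ _ _ → refl)
total-polyMul (x ∷ f) {b} {K} {suc N} b≡0 (s≤s L+K≤N) = begin
  total (suc N) (λ n → x * b n + shift g n)
    ≡⟨ total-add (suc N) (λ n → x * b n) (shift g) ⟩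
  total (suc N) (λ n → x * b n) + (+ 0 + total N g)
    ≡⟨ cong₂ _+_ (total-scale (suc N) x b) (ℤₚ.+-identityˡ _) ⟩
  x * total (suc N) b + total N g
    ≡⟨ cong₂ (λ t u → x * t + u) (total-stable b≡0 K≤N+1) (total-polyMul f b≡0 L+K≤N) ⟩
  x * total K b + sumℤ f * total K b
    ≡⟨ ℤₚ.*-distribʳ-+ (total K b) x (sumℤ f) ⟨
  (x + sumℤ f) * total K b ∎
  where
  open ≡-Reasoning
  g : PowerSeries
  g = polyMul f b
  K≤N+1 : K ≤ suc N
  K≤N+1 = ℕₚ.m≤n⇒m≤1+n (ℕₚ.≤-trans (ℕₚ.m≤n+m K (length f)) L+K≤N)

moment-polyMul : ∀ f {b K N} → VanishesFrom K b → length f ℕ.+ K ≤ N →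
                 moment N (polyMul f b) ≡ derivAt1 f * total K b + sumℤ f * moment K b
moment-polyMul []      {N = N} _ _ = total-zero N _ (λ n _ → ℤₚ.*-zeroʳ (+ n))
moment-polyMul (x ∷ f) {b} {K} {suc N} b≡0 (s≤s L+K≤N) = begin
  moment (suc N) (λ n → x * b n + shift g n)
    ≡⟨ moment-add (suc N) (λ n → x * b n) (shift g) ⟩
  moment (suc N) (λ n → x * b n) + moment (suc N) (shift g)
    ≡⟨ cong₂ _+_ (moment-scale (suc N) x b) (moment-suc N (shift g)) ⟩
  x * moment (suc N) b + (moment N g + total N g)
    ≡⟨ cong₂ (λ m u → x * m + u) (moment-stable b≡0 K≤N+1)
             (cong₂ _+_ (moment-polyMul f b≡0 L+K≤N) (total-polyMul f b≡0 L+K≤N)) ⟩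
  x * moment K b + ((derivAt1 f * total K b + sumℤ f * moment K b) + sumℤ f * total K b)
    ≡⟨ lemma x (derivAt1 f) (sumℤ f) (total K b) (moment K b) ⟩
  (derivAt1 f + sumℤ f) * total K b + (x + sumℤ f) * moment K b
    ≡⟨ cong (λ d → d * total K b + (x + sumℤ f) * moment K b) (derivAt1-∷ x f) ⟨
  derivAt1 (x ∷ f) * total K b + sumℤ (x ∷ f) * moment K b ∎
  where
  open ≡-Reasoning
  g : PowerSeries
  g = polyMul f b
  K≤N+1 : K ≤ suc N
  K≤N+1 = ℕₚ.m≤n⇒m≤1+n (ℕₚ.≤-trans (ℕₚ.m≤n+m K (length f)) L+K≤N)
  lemma : ∀ x d s t m → x * m + ((d * t + s * m) + s * t) ≡ (d + s) * t + (x + s) * m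
  lemma = solve-∀

module SubstPow (v : ℕ) where
  w : ℕ
  w = suc v

  private
    onMultiples : PowerSeries → ℕ → ℕ → ℤ
    onMultiples e zero    q = e q
    onMultiples e (suc _) q = + 0

    substPow-divMod : ∀ e n → substPow w e n ≡ onMultiples e (n % w) (n / w)
    substPow-divMod e n with n % w
    ... | zero  = refl
    ... | suc _ = refl

  substPow-+ : ∀ e n → substPow w e (w ℕ.+ n) ≡ substPow w (e ∘ suc) n
  substPow-+ e n = begin
    substPow w e (w ℕ.+ n)                                      ≡⟨ substPow-divMod e (w ℕ.+ n) ⟩
    onMultiples e ((w ℕ.+ n) % w) ((w ℕ.+ n) / w)               ≡⟨ cong₂ (onMultiples e) w+n%w w+n/w ⟩
    onMultiples e (n % w) (suc (n / w))                         ≡⟨ onMultiples-suc (n % w) ⟩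
    onMultiples (e ∘ suc) (n % w) (n / w)                       ≡⟨ substPow-divMod (e ∘ suc) n ⟨
    substPow w (e ∘ suc) n                                      ∎
    where
    open ≡-Reasoning
    w+n%w : (w ℕ.+ n) % w ≡ n % w
    w+n%w = trans (cong (_% w) (ℕₚ.+-comm w n)) ([m+n]%n≡m%n n w)
    w+n/w : (w ℕ.+ n) / w ≡ suc (n / w)
    w+n/w = trans (m/n≡1+[m∸n]/n (ℕₚ.m≤m+n w n)) (cong (λ m → suc (m / w)) (ℕₚ.m+n∸m≡n w n))
    onMultiples-suc : ∀ r → onMultiples e r (suc (n / w)) ≡ onMultiples (e ∘ suc) r (n / w)
    onMultiples-suc zero    = refl
    onMultiples-suc (suc r) = refl

  substPow-< : ∀ e {n} → 0 < n → n < w → substPow w e n ≡ + 0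
  substPow-< e {n} 0<n n<w with n % w in n%w
  ... | zero  = ⊥-elim (ℕₚ.<⇒≢ 0<n (sym (trans (sym (m<n⇒m%n≡m n<w)) n%w)))
  ... | suc _ = refl

  substPow-⊖ : ∀ a b → substPow w (a ⊖ b) ≗ substPow w a ⊖ substPow w b
  substPow-⊖ a b n with n % w
  ... | zero  = refl
  ... | suc _ = refl

  substPow-vanishes : ∀ {K e} → VanishesFrom (suc K) e → VanishesFrom (suc (K ℕ.* w)) (substPow w e)
  substPow-vanishes {K} {e} e≡0 n Kw<n with n % w in n%w
  ... | zero  = e≡0 (n / w) (ℕₚ.*-cancelʳ-< w K (n / w) (subst (K ℕ.* w <_) n≡[n/w]*w Kw<n))
    where
    n≡[n/w]*w : n ≡ n / w ℕ.* w
    n≡[n/w]*w = trans (m≡m%n+[m/n]*n n w) (cong (ℕ._+ n / w ℕ.* w) n%w)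
  ... | suc _ = refl

  substPow-* : ∀ e K → substPow w e (K ℕ.* w) ≡ e K
  substPow-* e zero    = refl
  substPow-* e (suc K) = trans (substPow-+ e (K ℕ.* w)) (substPow-* (e ∘ suc) K)

  shiftBy-substPow : ∀ e → shiftBy w (substPow w e) ≗ substPow w (shift e)
  shiftBy-substPow e n with n ℕ.<? w
  ... | yes n<w = trans (shiftBy-< w _ n<w) (sym (below n n<w))
    where
    below : ∀ n → n < w → substPow w (shift e) n ≡ + 0
    below zero    _   = refl
    below (suc n) n<w = substPow-< (shift e) (s≤s z≤n) n<w
  ... | no n≮w = subst (λ m → shiftBy w (substPow w e) m ≡ substPow w (shift e) m) (ℕₚ.m+[n∸m]≡n (ℕₚ.≮⇒≥ n≮w))
                       (trans (shiftBy-+ w _ (n ℕ.∸ w)) (sym (substPow-+ (shift e) (n ℕ.∸ w))))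

  total-substPow : ∀ K e → total (K ℕ.* w) (substPow w e) ≡ total K e
  total-substPow zero    e = refl
  total-substPow (suc K) e = begin
    total (w ℕ.+ K ℕ.* w) (substPow w e)
      ≡⟨ total-split w (K ℕ.* w) (substPow w e) ⟩
    total w (substPow w e) + total (K ℕ.* w) (λ n → substPow w e (w ℕ.+ n))
      ≡⟨ cong₂ _+_ first-block (total-cong (K ℕ.* w) (substPow-+ e)) ⟩
    e 0 + total (K ℕ.* w) (substPow w (e ∘ suc))
      ≡⟨ cong (_+_ (e 0)) (total-substPow K (e ∘ suc)) ⟩
    total (suc K) e ∎
    where
    open ≡-Reasoning
    first-block : total w (substPow w e) ≡ e 0
    first-block = trans (cong (_+_ (e 0)) (total-zero v _ (λ n n<v → substPow-< e (s≤s z≤n) (s≤s n<v))))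
                        (ℤₚ.+-identityʳ (e 0))

  moment-substPow : ∀ K e → moment (K ℕ.* w) (substPow w e) ≡ + w * moment K e
  moment-substPow zero    e = sym (ℤₚ.*-zeroʳ (+ w))
  moment-substPow (suc K) e = begin
    moment (w ℕ.+ K ℕ.* w) (substPow w e)
      ≡⟨ moment-split w (K ℕ.* w) (substPow w e) ⟩
    moment w (substPow w e) + (moment (K ℕ.* w) e′ + + w * total (K ℕ.* w) e′)
      ≡⟨ cong₂ (λ m u → m + (u + + w * total (K ℕ.* w) e′)) first-block
               (trans (moment-cong (K ℕ.* w) (substPow-+ e)) (moment-substPow K (e ∘ suc))) ⟩
    + 0 + (+ w * moment K (e ∘ suc) + + w * total (K ℕ.* w) e′)
      ≡⟨ cong (λ t → + 0 + (+ w * moment K (e ∘ suc) + + w * t))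
              (trans (total-cong (K ℕ.* w) (substPow-+ e)) (total-substPow K (e ∘ suc))) ⟩
    + 0 + (+ w * moment K (e ∘ suc) + + w * total K (e ∘ suc))
      ≡⟨ trans (ℤₚ.+-identityˡ _) (sym (ℤₚ.*-distribˡ-+ (+ w) (moment K (e ∘ suc)) (total K (e ∘ suc)))) ⟩
    + w * (moment K (e ∘ suc) + total K (e ∘ suc))
      ≡⟨ cong (_*_ (+ w)) (moment-suc K e) ⟨
    + w * moment (suc K) e ∎
    where
    open ≡-Reasoning
    e′ : PowerSeries
    e′ n = substPow w e (w ℕ.+ n)
    first-block : moment w (substPow w e) ≡ + 0
    first-block = total-zero w _ weighted-zero
      where
      weighted-zero : ∀ n → n < w → + n * substPow w e n ≡ + 0
      weighted-zero zero    _   = refl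
      weighted-zero (suc n) n<w = trans (cong (_*_ (+ suc n)) (substPow-< e (s≤s z≤n) n<w)) (ℤₚ.*-zeroʳ (+ suc n))

-- Numerical semigroups

total-indicator : ∀ (m : ℕ → Bool) M → total M (λ n → if m n then + 1 else + 0) + + countGaps m M ≡ + M
total-indicator m zero    = refl
total-indicator m (suc M) = begin
  total (suc M) h + + countGaps m (suc M)             ≡⟨ cong (_+ + countGaps m (suc M)) (total-snoc M h) ⟩
  (total M h + h M) + + countGaps m (suc M)           ≡⟨ ℤₚ.+-assoc (total M h) (h M) _ ⟩
  total M h + (h M + + countGaps m (suc M))           ≡⟨ cong (_+_ (total M h)) (step (m M) (countGaps m M)) ⟩
  total M h + (+ 1 + + countGaps m M)                 ≡⟨ +-CS.x∙yz≈y∙xz (total M h) (+ 1) _ ⟩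
  + 1 + (total M h + + countGaps m M)                 ≡⟨ cong (_+_ (+ 1)) (total-indicator m M) ⟩
  + suc M                                             ∎
  where
  open ≡-Reasoning
  h : PowerSeries
  h n = if m n then + 1 else + 0
  step : ∀ b g → (if b then + 1 else + 0) + + (if b then g else suc g) ≡ + 1 + + g
  step true  g = refl
  step false g = refl

countGaps-stable : ∀ m {C} → (∀ n → C ≤ n → m n ≡ true) → ∀ k → countGaps m (k ℕ.+ C) ≡ countGaps m C
countGaps-stable m m≡true zero    = refl
countGaps-stable m {C} m≡true (suc k) rewrite m≡true (k ℕ.+ C) (ℕₚ.m≤n+m C k) = countGaps-stable m m≡true k

conductorBelow : (ℕ → Bool) → ℕ → ℕ
conductorBelow m zero    = 0
conductorBelow m (suc n) = if m n then conductorBelow m n else suc n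

lastGap≡conductorBelow-1 : ∀ m n → lastGap m n ≡ + conductorBelow m n - + 1
lastGap≡conductorBelow-1 m zero    = refl
lastGap≡conductorBelow-1 m (suc n) with m n
... | true  = lastGap≡conductorBelow-1 m n
... | false = sym (trans (cong (_- + 1) (ℤₚ.pos-+ 1 n)) (lemma (+ n)))
  where
  lemma : ∀ x → + 1 + x - + 1 ≡ x
  lemma = solve-∀

conductorBelow-≤ : ∀ m n → conductorBelow m n ≤ n
conductorBelow-≤ m zero    = z≤n
conductorBelow-≤ m (suc n) with m n
... | true  = ℕₚ.m≤n⇒m≤1+n (conductorBelow-≤ m n)
... | false = ℕₚ.≤-refl

conductorBelow-member : ∀ m K {n} → conductorBelow m K ≤ n → n < K → m n ≡ true
conductorBelow-member m (suc K) {n} c≤n n<1+K with m K in mK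
... | false = ⊥-elim (ℕₚ.<⇒≱ n<1+K c≤n)
... | true  with n ℕ.≟ K
...   | yes refl = mK
...   | no  n≢K  = conductorBelow-member m K c≤n (ℕₚ.≤∧≢⇒< (ℕ.s≤s⁻¹ n<1+K) n≢K)

conductorBelow-gap : ∀ m K {p} → conductorBelow m K ≡ suc p → m p ≡ false
conductorBelow-gap m (suc K) c≡1+p with m K in mK
... | true  = conductorBelow-gap m K c≡1+p
... | false with refl ← c≡1+p = mK

conductor : NumericalSemigroup → ℕ
conductor S = conductorBelow (mem S) (bound S)

frobenius≡conductor-1 : ∀ S → frobenius S ≡ + conductor S - + 1
frobenius≡conductor-1 S = lastGap≡conductorBelow-1 (mem S) (bound S)

member-≥conductor : ∀ S {n} → conductor S ≤ n → mem S n ≡ true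
member-≥conductor S {n} c≤n with n ℕ.<? bound S
... | yes n<bound = conductorBelow-member (mem S) (bound S) c≤n n<bound
... | no  n≮bound = cofinite S n (ℕₚ.≮⇒≥ n≮bound)

hilbert-≥conductor : ∀ S {n} → conductor S ≤ n → hilbert S n ≡ + 1
hilbert-≥conductor S c≤n rewrite member-≥conductor S c≤n = refl

hilbert-gap : ∀ S {p} → conductor S ≡ suc p → hilbert S p ≡ + 0
hilbert-gap S c≡1+p rewrite conductorBelow-gap (mem S) (bound S) c≡1+p = refl

hilbert-0 : ∀ S → hilbert S 0 ≡ + 1
hilbert-0 S rewrite zero∈ S = refl

genus≡countGaps-conductor : ∀ S → genus S ≡ countGaps (mem S) (conductor S)
genus≡countGaps-conductor S =
  trans (cong (countGaps (mem S)) (sym (ℕₚ.m∸n+n≡m (conductorBelow-≤ (mem S) (bound S)))))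
        (countGaps-stable (mem S) (λ n → member-≥conductor S) (bound S ℕ.∸ conductor S))

semigroupPolynomial : NumericalSemigroup → PowerSeries
semigroupPolynomial S = hilbert S ⊖ shift (hilbert S)

semigroupPolynomial-vanishes : ∀ S → VanishesFrom (suc (conductor S)) (semigroupPolynomial S)
semigroupPolynomial-vanishes S (suc n) (s≤s c≤n) =
  cong₂ _-_ (hilbert-≥conductor S (ℕₚ.m≤n⇒m≤1+n c≤n)) (hilbert-≥conductor S c≤n)

semigroupPolynomial-conductor : ∀ S → semigroupPolynomial S (conductor S) ≡ + 1
semigroupPolynomial-conductor S with conductor S in c≡
... | zero  = cong (_- + 0) (hilbert-≥conductor S (ℕₚ.≤-reflexive c≡))
... | suc p = cong₂ _-_ (hilbert-≥conductor S (ℕₚ.≤-reflexive c≡)) (hilbert-gap S c≡)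

total-semigroupPolynomial : ∀ S → total (suc (conductor S)) (semigroupPolynomial S) ≡ + 1
total-semigroupPolynomial S = trans (total-⊖shift (conductor S) (hilbert S)) (hilbert-≥conductor S ℕₚ.≤-refl)

moment-semigroupPolynomial : ∀ S → moment (suc (conductor S)) (semigroupPolynomial S) ≡ + genus S
moment-semigroupPolynomial S = begin
  moment (suc c) (semigroupPolynomial S)      ≡⟨ moment-⊖shift c (hilbert S) ⟩
  + c * hilbert S c - total c (hilbert S)     ≡⟨ cong (λ h → + c * h - total c (hilbert S)) (hilbert-≥conductor S ℕₚ.≤-refl) ⟩
  + c * + 1 - total c (hilbert S)             ≡⟨ cancel (total c (hilbert S)) (+ countGaps (mem S) c) (+ c) (total-indicator (mem S) c) ⟩
  + countGaps (mem S) c                       ≡⟨ cong +_ (genus≡countGaps-conductor S) ⟨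
  + genus S                                   ∎
  where
  open ≡-Reasoning
  c : ℕ
  c = conductor S
  cancel : ∀ t g k → t + g ≡ k → k * + 1 - t ≡ g
  cancel t g _ refl = lemma t g
    where
    lemma : ∀ t g → (t + g) * + 1 - t ≡ g
    lemma = solve-∀

module Factorization (S T : NumericalSemigroup) (v : ℕ) (f : Poly)
                     (hyp : polyMul f (substPow (suc v) (hilbert S)) ≗ hilbert T) where
  open SubstPow v
  open ≡-Reasoning

  P-S P-S[xʷ] P-T : PowerSeries
  P-S     = semigroupPolynomial S
  P-S[xʷ] = substPow w P-S
  P-T     = semigroupPolynomial T

  ones : Poly
  ones = replicate w (+ 1)

  key-identity : polyMul f P-S[xʷ] ≗ polyMul ones P-T
  key-identity n = begin
    polyMul f P-S[xʷ] n                       ≡⟨ polyMul-cong f P-S[xʷ]≗ n ⟩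
    polyMul f (a ⊖ shiftBy w a) n             ≡⟨ polyMul-⊖ f a (shiftBy w a) n ⟩
    polyMul f a n - polyMul f (shiftBy w a) n ≡⟨ cong₂ _-_ (hyp n) (trans (polyMul-shiftBy f w a n) (shiftBy-cong w hyp n)) ⟩
    hilbert T n - shiftBy w (hilbert T) n     ≡⟨ polyMul-replicate-one w (hilbert T) n ⟨
    polyMul ones P-T n                        ∎
    where
    a : PowerSeries
    a = substPow w (hilbert S)
    P-S[xʷ]≗ : P-S[xʷ] ≗ a ⊖ shiftBy w a
    P-S[xʷ]≗ k = trans (substPow-⊖ (hilbert S) (shift (hilbert S)) k)
                       (cong (_-_ (a k)) (sym (shiftBy-substPow (hilbert S) k)))

  constantTerm : evalAt0 f ≡ + 1
  constantTerm = begin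
    coeff f 0                            ≡⟨ ℤₚ.*-identityʳ (coeff f 0) ⟨
    coeff f 0 * + 1                      ≡⟨ cong (_*_ (coeff f 0)) (hilbert-0 S) ⟨
    coeff f 0 * hilbert S 0              ≡⟨ polyMul-0 f (substPow w (hilbert S)) ⟨
    polyMul f (substPow w (hilbert S)) 0 ≡⟨ hyp 0 ⟩
    hilbert T 0                          ≡⟨ hilbert-0 T ⟩
    + 1                                  ∎

  P-S[xʷ]-vanishes : VanishesFrom (suc (conductor S ℕ.* w)) P-S[xʷ]
  P-S[xʷ]-vanishes = substPow-vanishes (semigroupPolynomial-vanishes S)

  K-S K-T N : ℕ
  K-S = suc (conductor S) ℕ.* w
  K-T = suc (conductor T)
  N   = (length f ℕ.+ K-S) ℕ.+ (length ones ℕ.+ K-T)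

  P-S[xʷ]-vanishes-K-S : VanishesFrom K-S P-S[xʷ]
  P-S[xʷ]-vanishes-K-S n K-S≤n = P-S[xʷ]-vanishes n (ℕₚ.≤-trans (s≤s (ℕₚ.m≤n+m _ v)) K-S≤n)

  total-P-S[xʷ] : total K-S P-S[xʷ] ≡ + 1
  total-P-S[xʷ] = trans (total-substPow (suc (conductor S)) P-S) (total-semigroupPolynomial S)

  moment-P-S[xʷ] : moment K-S P-S[xʷ] ≡ + w * + genus S
  moment-P-S[xʷ] = trans (moment-substPow (suc (conductor S)) P-S) (cong (_*_ (+ w)) (moment-semigroupPolynomial S))

  total-lhs : total N (polyMul f P-S[xʷ]) ≡ sumℤ f * + 1
  total-lhs = trans (total-polyMul f P-S[xʷ]-vanishes-K-S (ℕₚ.m≤m+n _ _)) (cong (_*_ (sumℤ f)) total-P-S[xʷ])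

  moment-lhs : moment N (polyMul f P-S[xʷ]) ≡ derivAt1 f * + 1 + sumℤ f * (+ w * + genus S)
  moment-lhs = trans (moment-polyMul f P-S[xʷ]-vanishes-K-S (ℕₚ.m≤m+n _ _))
                     (cong₂ (λ t m → derivAt1 f * t + sumℤ f * m) total-P-S[xʷ] moment-P-S[xʷ])

  total-rhs : total N (polyMul ones P-T) ≡ + w * + 1
  total-rhs = trans (total-polyMul ones (semigroupPolynomial-vanishes T) (ℕₚ.m≤n+m (length ones ℕ.+ K-T) (length f ℕ.+ K-S)))
                    (cong₂ _*_ (sumℤ-replicate-one w) (total-semigroupPolynomial T))

  moment-rhs : moment N (polyMul ones P-T) ≡ derivAt1 ones * + 1 + + w * + genus T
  moment-rhs = trans (moment-polyMul ones (semigroupPolynomial-vanishes T) (ℕₚ.m≤n+m (length ones ℕ.+ K-T) (length f ℕ.+ K-S)))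
                     (cong₂ (λ t m → derivAt1 ones * t + m) (total-semigroupPolynomial T)
                            (cong₂ _*_ (sumℤ-replicate-one w) (moment-semigroupPolynomial T)))

  valueAtOne : evalAt1 f ≡ + w
  valueAtOne = begin
    sumℤ f                      ≡⟨ ℤₚ.*-identityʳ (sumℤ f) ⟨
    sumℤ f * + 1                ≡⟨ total-lhs ⟨
    total N (polyMul f P-S[xʷ]) ≡⟨ total-cong N key-identity ⟩
    total N (polyMul ones P-T)  ≡⟨ total-rhs ⟩
    + w * + 1                   ≡⟨ ℤₚ.*-identityʳ (+ w) ⟩
    + w                         ∎

  derivativeAtOne : + 2 * derivAt1 f ≡ + w * (+ 2 * + genus T - + 2 * (+ w * + genus S) + (+ w - + 1))
  derivativeAtOne = solve-for-d (derivAt1 f) (derivAt1 ones) (+ w) (+ genus S) (+ genus T)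
    (begin
      derivAt1 f * + 1 + + w * (+ w * + genus S)    ≡⟨ cong (λ s → derivAt1 f * + 1 + s * (+ w * + genus S)) valueAtOne ⟨
      derivAt1 f * + 1 + sumℤ f * (+ w * + genus S) ≡⟨ moment-lhs ⟨
      moment N (polyMul f P-S[xʷ])                  ≡⟨ moment-cong N key-identity ⟩
      moment N (polyMul ones P-T)                   ≡⟨ moment-rhs ⟩
      derivAt1 ones * + 1 + + w * + genus T         ∎)
    (derivAt1-replicate-one w)
    where
    solve-for-d : ∀ d e w gS gT → d * + 1 + w * (w * gS) ≡ e * + 1 + w * gT → + 2 * e ≡ w * (w - + 1) →
                  + 2 * d ≡ w * (+ 2 * gT - + 2 * (w * gS) + (w - + 1))
    solve-for-d d e w gS gT moments 2e≡w[w-1] = begin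
      + 2 * d                                                 ≡⟨ lemma₁ d w gS ⟩
      + 2 * (d * + 1 + w * (w * gS)) - + 2 * (w * (w * gS))   ≡⟨ cong (λ m → + 2 * m - + 2 * (w * (w * gS))) moments ⟩
      + 2 * (e * + 1 + w * gT) - + 2 * (w * (w * gS))         ≡⟨ lemma₂ e w gS gT ⟩
      + 2 * e + + 2 * (w * gT) - + 2 * (w * (w * gS))         ≡⟨ cong (λ x → x + + 2 * (w * gT) - + 2 * (w * (w * gS))) 2e≡w[w-1] ⟩
      w * (w - + 1) + + 2 * (w * gT) - + 2 * (w * (w * gS))   ≡⟨ lemma₃ w gS gT ⟩
      w * (+ 2 * gT - + 2 * (w * gS) + (w - + 1))             ∎
      where
      lemma₁ : ∀ d w gS → + 2 * d ≡ + 2 * (d * + 1 + w * (w * gS)) - + 2 * (w * (w * gS))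
      lemma₁ = solve-∀
      lemma₂ : ∀ e w gS gT → + 2 * (e * + 1 + w * gT) - + 2 * (w * (w * gS)) ≡ + 2 * e + + 2 * (w * gT) - + 2 * (w * (w * gS))
      lemma₂ = solve-∀
      lemma₃ : ∀ w gS gT → w * (w - + 1) + + 2 * (w * gT) - + 2 * (w * (w * gS)) ≡ w * (+ 2 * gT - + 2 * (w * gS) + (w - + 1))
      lemma₃ = solve-∀

  lhs-top : polyMul f P-S[xʷ] (deg f ℕ.+ conductor S ℕ.* w) ≡ coeff f (deg f)
  lhs-top = begin
    polyMul f P-S[xʷ] (deg f ℕ.+ conductor S ℕ.* w)
      ≡⟨ polyMul-leading f (deg f) _ (coeff-vanishes-above-deg f) P-S[xʷ]-vanishes ⟩
    coeff f (deg f) * P-S[xʷ] (conductor S ℕ.* w)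
      ≡⟨ cong (_*_ (coeff f (deg f))) (trans (substPow-* P-S (conductor S)) (semigroupPolynomial-conductor S)) ⟩
    coeff f (deg f) * + 1
      ≡⟨ ℤₚ.*-identityʳ _ ⟩
    coeff f (deg f) ∎

  rhs-top : polyMul ones P-T (v ℕ.+ conductor T) ≡ + 1
  rhs-top = trans (polyMul-leading ones v _ (coeff-replicate-vanishes w (+ 1)) (semigroupPolynomial-vanishes T))
                  (cong₂ _*_ (coeff-replicate-< (+ 1) (ℕₚ.n<1+n v)) (semigroupPolynomial-conductor T))

  -- Both sides of the key identity have their last nonzero coefficient at the same place.
  degree : deg f ℕ.+ conductor S ℕ.* w ≡ v ℕ.+ conductor T
  degree = ℕₚ.≤-antisym
    (ℕ.s≤s⁻¹ (nonzero⇒below-support lhs-top≢0 (λ n le → trans (key-identity n) (rhs-vanishes n le))))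
    (ℕ.s≤s⁻¹ (nonzero⇒below-support rhs-top≢0 (λ n le → trans (sym (key-identity n)) (lhs-vanishes n le))))
    where
    lhs-vanishes : VanishesFrom (suc (deg f ℕ.+ conductor S ℕ.* w)) (polyMul f P-S[xʷ])
    lhs-vanishes = polyMul-vanishes f (deg f) _ (coeff-vanishes-above-deg f) P-S[xʷ]-vanishes
    rhs-vanishes : VanishesFrom (suc (v ℕ.+ conductor T)) (polyMul ones P-T)
    rhs-vanishes = polyMul-vanishes ones v _ (coeff-replicate-vanishes w (+ 1)) (semigroupPolynomial-vanishes T)
    f₀≢0 : coeff f 0 ≢ + 0
    f₀≢0 f₀≡0 with () ← trans (sym constantTerm) f₀≡0
    lhs-top≢0 : polyMul f P-S[xʷ] (deg f ℕ.+ conductor S ℕ.* w) ≢ + 0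
    lhs-top≢0 = subst (_≢ + 0) (sym lhs-top) (leadingCoeff≢0 f (isZeroPoly≡false f f₀≢0))
    rhs-top≢0 : polyMul ones P-T (v ℕ.+ conductor T) ≢ + 0
    rhs-top≢0 top≡0 with () ← trans (sym rhs-top) top≡0

  frobeniusRelation : frobenius T ≡ + w * frobenius S + + deg f
  frobeniusRelation = begin
    frobenius T                            ≡⟨ frobenius≡conductor-1 T ⟩
    + c-T - + 1                            ≡⟨ solve-for-c-T (+ deg f) (+ c-S) (+ c-T) (+ v) degreeℤ ⟩
    (+ 1 + + v) * (+ c-S - + 1) + + deg f  ≡⟨ cong₂ (λ x y → x * y + + deg f) (ℤₚ.pos-+ 1 v) (frobenius≡conductor-1 S) ⟨
    + w * frobenius S + + deg f            ∎
    where
    c-S c-T : ℕ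
    c-S = conductor S
    c-T = conductor T
    degreeℤ : + deg f + + c-S * (+ 1 + + v) ≡ + v + + c-T
    degreeℤ = begin
      + deg f + + c-S * (+ 1 + + v) ≡⟨ cong (λ x → + deg f + + c-S * x) (ℤₚ.pos-+ 1 v) ⟨
      + deg f + + c-S * + w         ≡⟨ cong (_+_ (+ deg f)) (ℤₚ.pos-* c-S w) ⟨
      + deg f + + (c-S ℕ.* w)       ≡⟨ ℤₚ.pos-+ (deg f) (c-S ℕ.* w) ⟨
      + (deg f ℕ.+ c-S ℕ.* w)       ≡⟨ cong +_ degree ⟩
      + (v ℕ.+ c-T)                 ≡⟨ ℤₚ.pos-+ v c-T ⟩
      + v + + c-T                   ∎
    solve-for-c-T : ∀ D cS cT v → D + cS * (+ 1 + v) ≡ v + cT → cT - + 1 ≡ (+ 1 + v) * (cS - + 1) + D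
    solve-for-c-T D cS cT v eq = begin
      cT - + 1                        ≡⟨ lemma₁ cT v ⟩
      (v + cT) - v - + 1              ≡⟨ cong (λ x → x - v - + 1) eq ⟨
      (D + cS * (+ 1 + v)) - v - + 1  ≡⟨ lemma₂ D cS v ⟩
      (+ 1 + v) * (cS - + 1) + D      ∎
      where
      lemma₁ : ∀ cT v → cT - + 1 ≡ (v + cT) - v - + 1
      lemma₁ = solve-∀
      lemma₂ : ∀ D cS v → (D + cS * (+ 1 + v)) - v - + 1 ≡ (+ 1 + v) * (cS - + 1) + D
      lemma₂ = solve-∀

mainTheorem15 : (S T : NumericalSemigroup) (w : ℕ) .{{_ : NonZero w}} (f : Poly) →
    (∀ n → mulPolyPS f (substPow w (hilbert S)) n ≡ hilbert T n) →
    (evalAt0 f ≡ + 1)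
    × (evalAt1 f ≡ + w)
    × ((+ 2) * derivAt1 f ≡ (+ w) * ((+ 2) * (+ genus T) - (+ 2) * ((+ w) * (+ genus S)) + ((+ w) - (+ 1))))
    × (frobenius T ≡ (+ w) * frobenius S + (+ deg f))
mainTheorem15 S T zero {{w≢0}} f hyp = ⊥-elim-irr (NonZero.nonZero w≢0)
mainTheorem15 S T (suc v) f hyp = constantTerm , valueAtOne , derivativeAtOne , frobeniusRelation
  where open Factorization S T v f (λ n → trans (sym (mulPolyPS≗polyMul f _ n)) (hyp n))
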